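{- Let $T=(V,E)$ be a finite tree with a distinguished node $v^\ast$, and let $\mathcal{M}\in\{\mathcal{MIN},\mathcal{MAJ}\}$. Then there exists a bijection between $E_{fix}(T)$ and $\mathcal{F}_{\mathcal{M}}(T)^+$.
   Context: A coloring of $T$ is a map $c:V\to\{0,1\}$. For a node $v$ and $i\in\{0,1\}$, $N^i(v)$ denotes the set of neighbors of $v$ with color $i$. The minority process maps $c$ to $\mathcal{MIN}(c)$ with $\mathcal{MIN}(c)(v)=c(v)$ if $|N^{c(v)}(v)|\le|N^{1-c(v)}(v)|$ and $\mathcal{MIN}(c)(v)=1-c(v)$ otherwise. The majority process $\mathcal{MAJ}$ is defined by $\mathcal{MAJ}(c)(v)=c(v)$ if $|N^{c(v)}(v)|\ge|N^{1-c(v)}(v)|$ and $1-c(v)$ otherwise (all nodes update simultaneously). A coloring $c$ is a fixed point of $\mathcal{M}$ if $\mathcal{M}(c)=c$; $\mathcal{F}_{\mathcal{M}}(T)$ is the set of fixed points and $\mathcal{F}_{\mathcal{M}}(T)^+$ the set of fixed points $c$ with $c(v^\ast)=0$. $E^2(T)$ is the set of edges of $T$ both of whose end nodes have degree at least $2$. For $F\subseteq E$ and a node $v$, $F_v$ denotes the number of edges of $F$ incident to $v$. A set $F\subseteq E^2(T)$ is legal if $F_v\le \deg(v)/2$ for every node $v$; $E_{fix}(T)$ is the set of all legal subsets of $E^2(T)$. -}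

module Defs where

open import Level using (0ℓ)
open import Data.Bool using (Bool; true; false; not; if_then_else_)
open import Data.Nat using (ℕ; zero; suc; _+_; _*_; _≤_; _≤ᵇ_; _<ᵇ_)
open import Data.Fin using (Fin)
import Data.Fin as Fin
open import Data.List using (List; []; _∷_; length; _∷ʳ_)
open import Data.List.Relation.Unary.Unique.Propositional using (Unique)
open import Data.List.Relation.Unary.Linked using (Linked)
open import Data.Product using (Σ; ∃; ∃-syntax; _×_; proj₁)
open import Relation.Nullary using (¬_)
open import Relation.Binary.PropositionalEquality using (_≡_; refl; sym; trans)
open import Relation.Binary.Bundles using (Setoid)

count : ∀ {n} → (Fin n → Bool) → ℕ
count {zero}  P = 0
count {suc n} P = (if P Fin.zero then 1 else 0) + count (λ i → P (Fin.suc i))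

record Graph (n : ℕ) : Set where
  field
    adj    : Fin n → Fin n → Bool
    adj-sym : ∀ i j → adj i j ≡ adj j i
    adj-irrefl : ∀ i → adj i i ≡ false

module _ {n : ℕ} (G : Graph n) where
  open Graph G

  Adj : Fin n → Fin n → Set
  Adj i j = adj i j ≡ true

  data Reach : Fin n → Fin n → Set where
    here : ∀ {i} → Reach i i
    step : ∀ {i j k} → Adj i j → Reach j k → Reach i k

  Connected : Set
  Connected = ∀ i j → Reach i j

  Cycle : Set
  Cycle = ∃[ x ] ∃[ xs ] (2 ≤ length xs × Unique (x ∷ xs) × Linked Adj ((x ∷ xs) ∷ʳ x))

  Acyclic : Set
  Acyclic = ¬ Cycle

  deg : Fin n → ℕ
  deg v = count (adj v)

record Tree (n : ℕ) : Set where
  field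
    graph     : Graph n
    connected : Connected graph
    acyclic   : Acyclic graph
  open Graph graph public

-- colour 0 is false, colour 1 is true
Coloring : ℕ → Set
Coloring n = Fin n → Bool

data Process : Set where
  MIN MAJ : Process

module _ {n : ℕ} (T : Tree n) where
  open Tree T

  eqᵇ : Bool → Bool → Bool
  eqᵇ true  b = b
  eqᵇ false b = not b

  N : Coloring n → Bool → Fin n → ℕ
  N c i v = count (λ u → if adj v u then eqᵇ (c u) i else false)

  step-of : Process → Coloring n → Coloring n
  step-of MIN c v = if N c (c v) v ≤ᵇ N c (not (c v)) v then c v else not (c v)
  step-of MAJ c v = if N c (not (c v)) v ≤ᵇ N c (c v) v then c v else not (c v)

  FixPlus : Process → Fin n → Coloring n → Set
  FixPlus M v* c = (∀ v → step-of M c v ≡ c v) × c v* ≡ false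

  -- edge sets F ⊆ E, represented as symmetric Bool-relations on vertices
  EdgeSet : Set
  EdgeSet = Fin n → Fin n → Bool

  Fdeg : EdgeSet → Fin n → ℕ
  Fdeg F v = count (F v)

  Legal : EdgeSet → Set
  Legal F = (∀ i j → F i j ≡ F j i)
          × (∀ i j → F i j ≡ true → Adj graph i j × 2 ≤ deg graph i × 2 ≤ deg graph j)
          × (∀ v → 2 * Fdeg F v ≤ deg graph v)

  Efix : Setoid 0ℓ 0ℓ
  Efix = record
    { Carrier = Σ EdgeSet Legal
    ; _≈_ = λ F G → ∀ i j → proj₁ F i j ≡ proj₁ G i j
    ; isEquivalence = record
      { refl = λ i j → refl
      ; sym = λ p i j → sym (p i j)
      ; trans = λ p q i j → trans (p i j) (q i j) } }

  FixSet : Process → Fin n → Setoid 0ℓ 0ℓ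
  FixSet M v* = record
    { Carrier = Σ (Coloring n) (FixPlus M v*)
    ; _≈_ = λ c d → ∀ v → proj₁ c v ≡ proj₁ d v
    ; isEquivalence = record
      { refl = λ v → refl
      ; sym = λ p v → sym (p v)
      ; trans = λ p q v → trans (p v) (q v) } }

{-# OPTIONS --safe #-}
-- A colouring is fixed iff every node v has at most deg(v)/2 neighbours "against" it
-- (neighbours of its own colour for MIN, of the other colour for MAJ), so the edges
-- joining such pairs form a legal set. Conversely, on a tree a legal set F determines
-- the colouring with c(v*) = 0 whose colour changes exactly along the edges prescribed
-- by F: colour v by the parity of the number of such edges on a walk from v* to v,
-- which does not depend on the walk because closed walks in an acyclic graph have even
-- parity.
module Submission where

open import Defs
open import Data.Bool using (Bool; true; false; not; if_then_else_; _xor_)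
open import Data.Bool.Properties using (xor-assoc; xor-comm; xor-same; xor-identityʳ; not-¬; not-involutive)
open import Data.Empty using (⊥; ⊥-elim)
open import Data.Fin using (Fin; _≟_)
import Data.Fin as Fin
open import Data.List using (List; []; _∷_; _++_; _∷ʳ_)
open import Data.List.Properties using (length-++-sucʳ)
open import Data.List.Relation.Unary.All as All using (All; head)
open import Data.List.Relation.Unary.All.Properties using (++⁻ˡ; ++⁻ʳ; ∷ʳ⁺; ¬Any⇒All¬)
open import Data.List.Relation.Unary.AllPairs using (AllPairs; []; _∷_)
open import Data.List.Relation.Unary.Any using (here; there)
open import Data.List.Relation.Unary.Linked using (Linked; []; [-]; _∷_)
open import Data.List.Relation.Unary.Unique.Propositional using (Unique)
open import Data.List.Relation.Unary.Unique.Propositional.Properties using (Unique[x∷xs]⇒x∉xs)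
open import Data.List.Membership.Propositional using (_∈_)
open import Data.List.Membership.Propositional.Properties using (∈-∃++)
open import Data.Nat using (ℕ; zero; suc; _+_; _*_; _≤_; _≤ᵇ_; s≤s; z≤n)
open import Data.Nat.Properties
  using (≤ᵇ⇒≤; ≤⇒≤ᵇ; +-cancelˡ-≤; +-monoʳ-≤; +-identityʳ; +-comm; +-suc; ≤-trans; *-monoʳ-≤)
open import Data.Product using (_×_; _,_; proj₁; proj₂)
open import Function.Bundles using (Bijection; _⇔_; mk⇔; Equivalence)
open import Relation.Binary.PropositionalEquality
  using (_≡_; refl; sym; trans; cong; cong₂; subst; module ≡-Reasoning)
open import Relation.Nullary using (yes; no)

xor-cancelˡ : ∀ a b → a xor (a xor b) ≡ b
xor-cancelˡ a b = trans (sym (xor-assoc a a b)) (cong (_xor b) (xor-same a))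

xor≡false⇒≡ : ∀ {a b} → a xor b ≡ false → a ≡ b
xor≡false⇒≡ {a} {b} e = trans (sym (xor-identityʳ a)) (trans (cong (a xor_) (sym e)) (xor-cancelˡ a b))

xor-solveʳ : ∀ {a b c} → a xor b ≡ c → b ≡ a xor c
xor-solveʳ {a} {b} e = trans (sym (xor-cancelˡ a b)) (cong (a xor_) e)

if-false≡true⇒ : ∀ {a b} → (if a then b else false) ≡ true → a ≡ true
if-false≡true⇒ {true} _ = refl

count-cong : ∀ {n} {P Q : Fin n → Bool} → (∀ i → P i ≡ Q i) → count P ≡ count Q
count-cong {zero}  h = refl
count-cong {suc n} h =
  cong₂ _+_ (cong (λ b → if b then 1 else 0) (h Fin.zero)) (count-cong (λ i → h (Fin.suc i)))

count-split : ∀ {n} (A P : Fin n → Bool) →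
  count (λ u → if A u then P u else false) + count (λ u → if A u then not (P u) else false)
    ≡ count A
count-split {zero}  A P = refl
count-split {suc n} A P with A Fin.zero | P Fin.zero
... | false | _     = count-split (λ i → A (Fin.suc i)) (λ i → P (Fin.suc i))
... | true  | true  = cong suc (count-split (λ i → A (Fin.suc i)) (λ i → P (Fin.suc i)))
... | true  | false =
  trans (+-suc _ _) (cong suc (count-split (λ i → A (Fin.suc i)) (λ i → P (Fin.suc i))))

count-pos : ∀ {n} (P : Fin n → Bool) j → P j ≡ true → 1 ≤ count P
count-pos P Fin.zero    e rewrite e = s≤s z≤n
count-pos P (Fin.suc j) e with P Fin.zero
... | true  = s≤s z≤n
... | false = count-pos (λ i → P (Fin.suc i)) j e

AllPairs-truncate : ∀ {A : Set} {R : A → A → Set} xs {y ys} →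
  AllPairs R (xs ++ y ∷ ys) → AllPairs R (xs ∷ʳ y)
AllPairs-truncate []       (_ ∷ _)    = All.[] ∷ []
AllPairs-truncate (x ∷ xs) (px ∷ pxs) =
  ∷ʳ⁺ (++⁻ˡ xs px) (head (++⁻ʳ xs px)) ∷ AllPairs-truncate xs pxs

Linked-truncate : ∀ {A : Set} {R : A → A → Set} x xs {y ys z} →
  Linked R (x ∷ xs ++ y ∷ ys) → R y z → Linked R ((x ∷ (xs ∷ʳ y)) ∷ʳ z)
Linked-truncate x []        (rxy ∷ _) ryz = rxy ∷ ryz ∷ [-]
Linked-truncate x (x′ ∷ xs) (rxx′ ∷ l) ryz = rxx′ ∷ Linked-truncate x′ xs l ryz

module Walks {n : ℕ} (G : Graph n) where
  open Graph G

  private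
    Label : Set
    Label = Fin n → Fin n → Bool

    variable
      i j k : Fin n
      L L′ : Label

  Adj-sym : Adj G i j → Adj G j i
  Adj-sym {i} {j} a = trans (adj-sym j i) a

  Adj-irrefl : Adj G i i → ⊥
  Adj-irrefl {i} a = not-¬ (trans (sym a) (adj-irrefl i)) refl

  walkParity : Label → Reach G i j → Bool
  walkParity L here                 = false
  walkParity L (step {i} {j} _ p) = L i j xor walkParity L p

  _++ʷ_ : Reach G i j → Reach G j k → Reach G i k
  here     ++ʷ q = q
  step a p ++ʷ q = step a (p ++ʷ q)

  reverseʷ : Reach G i j → Reach G j i
  reverseʷ here       = here
  reverseʷ (step a p) = reverseʷ p ++ʷ step (Adj-sym a) here

  walkParity-++ : (p : Reach G i j) (q : Reach G j k) →
    walkParity L (p ++ʷ q) ≡ walkParity L p xor walkParity L q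
  walkParity-++       here               q = refl
  walkParity-++ {L = L} (step {i} {j} _ p) q =
    trans (cong (L i j xor_) (walkParity-++ p q)) (sym (xor-assoc (L i j) _ _))

  walkParity-reverse : (∀ i j → L i j ≡ L j i) → (p : Reach G i j) →
    walkParity L (reverseʷ p) ≡ walkParity L p
  walkParity-reverse         L-sym here = refl
  walkParity-reverse {L = L} L-sym (step {i} {j} a p) = begin
    walkParity L (reverseʷ p ++ʷ step (Adj-sym a) here) ≡⟨ walkParity-++ (reverseʷ p) _ ⟩
    walkParity L (reverseʷ p) xor (L j i xor false)     ≡⟨ cong₂ _xor_ (walkParity-reverse L-sym p) (xor-identityʳ _) ⟩
    walkParity L p xor L j i                            ≡⟨ xor-comm _ (L j i) ⟩
    L j i xor walkParity L p                            ≡⟨ cong (_xor walkParity L p) (L-sym j i) ⟩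
    L i j xor walkParity L p                            ∎
    where open ≡-Reasoning

  walkParity-cong : (∀ i j → L i j ≡ L′ i j) → (p : Reach G i j) →
    walkParity L p ≡ walkParity L′ p
  walkParity-cong h here               = refl
  walkParity-cong h (step {i} {j} _ p) = cong₂ _xor_ (h i j) (walkParity-cong h p)

  walkParity-telescopes : (d : Fin n → Bool) → (∀ u w → Adj G u w → L u w ≡ d u xor d w) →
    (p : Reach G i j) → walkParity L p ≡ d i xor d j
  walkParity-telescopes {i = i} d h here = sym (xor-same (d i))
  walkParity-telescopes {L = L} d h (step {i} {j} {k} a p) = begin
    L i j xor walkParity L p       ≡⟨ cong₂ _xor_ (h i j a) (walkParity-telescopes d h p) ⟩
    (d i xor d j) xor (d j xor d k) ≡⟨ xor-assoc (d i) (d j) _ ⟩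
    d i xor (d j xor (d j xor d k)) ≡⟨ cong (d i xor_) (xor-cancelˡ (d j) (d k)) ⟩
    d i xor d k                     ∎
    where open ≡-Reasoning

  module _ (acyclic : Acyclic G) (L : Label) (L-sym : ∀ i j → L i j ≡ L j i) where
    open import Data.List.Membership.DecPropositional (_≟_ {n}) using (_∈?_)

    SimplePath : Fin n → List (Fin n) → Set
    SimplePath t R = Unique (t ∷ R) × Linked (Adj G) (t ∷ R)

    pathEnd : Fin n → List (Fin n) → Fin n
    pathEnd t []      = t
    pathEnd t (s ∷ R) = pathEnd s R

    pathEnd∈ : ∀ s R → pathEnd s R ∈ s ∷ R
    pathEnd∈ s []       = here refl
    pathEnd∈ s (s′ ∷ R) = there (pathEnd∈ s′ R)

    pathParity : Fin n → List (Fin n) → Bool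
    pathParity t []      = false
    pathParity t (s ∷ R) = L t s xor pathParity s R

    shortcut-cycle : ∀ {t s y} R → SimplePath t (s ∷ R) → Adj G t y → y ∈ R → Cycle G
    shortcut-cycle {t} {s} {y} R (u , l) t~y y∈R with ∈-∃++ y∈R
    ... | q , r , refl =
      t , s ∷ (q ∷ʳ y) , subst (2 ≤_) (cong suc (sym (length-++-sucʳ q y []))) (s≤s (s≤s z≤n))
        , AllPairs-truncate (t ∷ s ∷ q) u , Linked-truncate t (s ∷ q) l (Adj-sym t~y)

    -- Each step either extends the path, retraces its first edge, or would close a cycle.
    walkParity≡pathParity : ∀ {t x} R → SimplePath t R → pathEnd t R ≡ x →
      (w : Reach G t x) → walkParity L w ≡ pathParity t R
    walkParity≡pathParity []      _            _   here = refl
    walkParity≡pathParity (s ∷ R) (u , _) end here =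
      ⊥-elim (Unique[x∷xs]⇒x∉xs u (subst (_∈ s ∷ R) end (pathEnd∈ s R)))
    walkParity≡pathParity {t} R p end (step {j = y} t~y w) with y ∈? t ∷ R
    walkParity≡pathParity {t} R (u , l) end (step {j = y} t~y w) | no y∉ = begin
      L t y xor walkParity L w             ≡⟨ cong (L t y xor_) (walkParity≡pathParity (t ∷ R) (¬Any⇒All¬ _ y∉ ∷ u , Adj-sym t~y ∷ l) end w) ⟩
      L t y xor (L y t xor pathParity t R) ≡⟨ cong (λ b → L t y xor (b xor pathParity t R)) (L-sym y t) ⟩
      L t y xor (L t y xor pathParity t R) ≡⟨ xor-cancelˡ (L t y) _ ⟩
      pathParity t R                       ∎
      where open ≡-Reasoning
    walkParity≡pathParity R p end (step t~y w) | yes (here refl) = ⊥-elim (Adj-irrefl t~y)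
    walkParity≡pathParity {t} (y ∷ R′) (_ ∷ u , _ ∷ l) end (step t~y w) | yes (there (here refl)) =
      cong (L t y xor_) (walkParity≡pathParity R′ (u , l) end w)
    walkParity≡pathParity (s ∷ R′) p end (step t~y w) | yes (there (there y∈R′)) =
      ⊥-elim (acyclic (shortcut-cycle R′ p t~y y∈R′))

    walkParity-closed : (w : Reach G i i) → walkParity L w ≡ false
    walkParity-closed w = walkParity≡pathParity [] (All.[] ∷ [] , [-]) refl w

    walkParity-irrelevant : (p q : Reach G i j) → walkParity L p ≡ walkParity L q
    walkParity-irrelevant p q = xor≡false⇒≡ (begin
      walkParity L p xor walkParity L q              ≡⟨ cong (walkParity L p xor_) (walkParity-reverse L-sym q) ⟨
      walkParity L p xor walkParity L (reverseʷ q)   ≡⟨ walkParity-++ p (reverseʷ q) ⟨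
      walkParity L (p ++ʷ reverseʷ q)                ≡⟨ walkParity-closed (p ++ʷ reverseʷ q) ⟩
      false                                          ∎)
      where open ≡-Reasoning

    label≡walkParity-xor : ∀ {r u w} (p : Reach G r u) (q : Reach G r w) → Adj G u w →
      L u w ≡ walkParity L p xor walkParity L q
    label≡walkParity-xor {u = u} {w} p q a = xor-solveʳ {walkParity L p} (begin
      walkParity L p xor L u w                    ≡⟨ cong (walkParity L p xor_) (xor-identityʳ (L u w)) ⟨
      walkParity L p xor walkParity L (step a here) ≡⟨ walkParity-++ p (step a here) ⟨
      walkParity L (p ++ʷ step a here)            ≡⟨ walkParity-irrelevant (p ++ʷ step a here) q ⟩
      walkParity L q                              ∎)
      where open ≡-Reasoning

-- Neighbours of colour clash M (c v) count against v: v keeps its colour iff at most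
-- half of its neighbours have that colour.
clash : Process → Bool → Bool
clash MIN b = b
clash MAJ b = not b

-- crossing M b: whether an edge inside (b = true) or outside the conflict set joins
-- endpoints of different colours.
crossing : Process → Bool → Bool
crossing MIN b = not b
crossing MAJ b = b

crossing-involutive : ∀ M b → crossing M (crossing M b) ≡ b
crossing-involutive MIN b = not-involutive b
crossing-involutive MAJ b = refl

if-≤ᵇ-stable⇒≤ : ∀ b {X Y} → (if X ≤ᵇ Y then b else not b) ≡ b → X ≤ Y
if-≤ᵇ-stable⇒≤ b {X} {Y} e with X ≤ᵇ Y | ≤ᵇ⇒≤ X Y
... | true  | X≤Y = X≤Y _
... | false | _   = ⊥-elim (not-¬ refl (sym e))

≤⇒if-≤ᵇ-stable : ∀ b {X Y} → X ≤ Y → (if X ≤ᵇ Y then b else not b) ≡ b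
≤⇒if-≤ᵇ-stable b {X} {Y} X≤Y with X ≤ᵇ Y | ≤⇒≤ᵇ X≤Y
... | true | _ = refl

≤⇔2*≤+ : ∀ {X Y} → X ≤ Y ⇔ 2 * X ≤ X + Y
≤⇔2*≤+ {X} {Y} rewrite +-identityʳ X = mk⇔ (+-monoʳ-≤ X) (+-cancelˡ-≤ X X Y)

balance⇔ : ∀ b X Y {D} → X + Y ≡ D → ((if X ≤ᵇ Y then b else not b) ≡ b) ⇔ (2 * X ≤ D)
balance⇔ b X Y refl = mk⇔ (λ e → Equivalence.to (≤⇔2*≤+ {X}) (if-≤ᵇ-stable⇒≤ b e))
                          (λ p → ≤⇒if-≤ᵇ-stable b (Equivalence.from (≤⇔2*≤+ {X}) p))

module _ {n : ℕ} (T : Tree n) where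
  open Tree T
  open Walks graph

  eqᵇ-not : ∀ x b → eqᵇ T x (not b) ≡ not (eqᵇ T x b)
  eqᵇ-not true  b = refl
  eqᵇ-not false b = refl

  eqᵇ-clash : ∀ M x y → eqᵇ T y (clash M x) ≡ crossing M (x xor y)
  eqᵇ-clash MIN true  true  = refl
  eqᵇ-clash MIN true  false = refl
  eqᵇ-clash MIN false true  = refl
  eqᵇ-clash MIN false false = refl
  eqᵇ-clash MAJ true  true  = refl
  eqᵇ-clash MAJ true  false = refl
  eqᵇ-clash MAJ false true  = refl
  eqᵇ-clash MAJ false false = refl

  N-split : ∀ c b v → N T c b v + N T c (not b) v ≡ deg graph v
  N-split c b v = trans
    (cong (N T c b v +_) (count-cong λ u → cong (λ e → if adj v u then e else false) (eqᵇ-not (c u) b)))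
    (count-split (adj v) (λ u → eqᵇ T (c u) b))

  stable⇔ : ∀ M c v → (step-of T M c v ≡ c v) ⇔ (2 * N T c (clash M (c v)) v ≤ deg graph v)
  stable⇔ MIN c v = balance⇔ (c v) (N T c (c v) v) (N T c (not (c v)) v) (N-split c (c v) v)
  stable⇔ MAJ c v = balance⇔ (c v) (N T c (not (c v)) v) (N T c (c v) v)
                              (trans (+-comm (N T c (not (c v)) v) _) (N-split c (c v) v))

  conflicts : Process → Coloring n → EdgeSet T
  conflicts M c u w = if adj u w then crossing M (c u xor c w) else false

  fixed⇔ : ∀ M c v → (step-of T M c v ≡ c v) ⇔ (2 * Fdeg T (conflicts M c) v ≤ deg graph v)
  fixed⇔ M c v rewrite count-cong {P = conflicts M c v} λ u →
    cong (λ b → if adj v u then b else false) (sym (eqᵇ-clash M (c v) (c u))) = stable⇔ M c v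

  conflicts-cong : ∀ M {c d} → (∀ v → c v ≡ d v) → ∀ u w → conflicts M c u w ≡ conflicts M d u w
  conflicts-cong M {c} {d} h u w =
    cong₂ (λ x y → if adj u w then crossing M (x xor y) else false) (h u) (h w)

  incident⇒2≤deg : ∀ (F : EdgeSet T) v u → F v u ≡ true → 2 * Fdeg T F v ≤ deg graph v → 2 ≤ deg graph v
  incident⇒2≤deg F v u e = ≤-trans (*-monoʳ-≤ 2 (count-pos (F v) u e))

  conflicts-legal : ∀ M c → (∀ v → step-of T M c v ≡ c v) → Legal T (conflicts M c)
  conflicts-legal M c fixed = symmetric , inside-E² , balanced
    where
    balanced : ∀ v → 2 * Fdeg T (conflicts M c) v ≤ deg graph v
    balanced v = Equivalence.to (fixed⇔ M c v) (fixed v)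

    symmetric : ∀ u w → conflicts M c u w ≡ conflicts M c w u
    symmetric u w = cong₂ (λ a x → if a then crossing M x else false) (adj-sym u w) (xor-comm (c u) (c w))

    inside-E² : ∀ u w → conflicts M c u w ≡ true → Adj graph u w × 2 ≤ deg graph u × 2 ≤ deg graph w
    inside-E² u w e = if-false≡true⇒ e
                    , incident⇒2≤deg (conflicts M c) u w e (balanced u)
                    , incident⇒2≤deg (conflicts M c) w u (trans (symmetric w u) e) (balanced w)

  Legal⇒non-edge : ∀ {F} → Legal T F → ∀ u w → adj u w ≡ false → F u w ≡ false
  Legal⇒non-edge {F} (_ , inside-E² , _) u w u≁w with F u w in e
  ... | false = refl
  ... | true  = ⊥-elim (not-¬ (proj₁ (inside-E² u w e)) u≁w)

  module _ (M : Process) (v* : Fin n) where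
    coloring : EdgeSet T → Coloring n
    coloring F v = walkParity (λ u w → crossing M (F u w)) (connected v* v)

    coloring-cong : ∀ {F F′ : EdgeSet T} → (∀ u w → F u w ≡ F′ u w) → ∀ v → coloring F v ≡ coloring F′ v
    coloring-cong h v = walkParity-cong (λ u w → cong (crossing M) (h u w)) (connected v* v)

    conflicts-coloring : ∀ {F} → Legal T F → ∀ u w → F u w ≡ conflicts M (coloring F) u w
    conflicts-coloring {F} legal u w with adj u w in u~w
    ... | false = Legal⇒non-edge legal u w u~w
    ... | true  = trans (sym (crossing-involutive M (F u w)))
                        (cong (crossing M) (label≡walkParity-xor acyclic _ L-sym (connected v* u) (connected v* w) u~w))
      where
      L-sym : ∀ i j → crossing M (F i j) ≡ crossing M (F j i)
      L-sym i j = cong (crossing M) (proj₁ legal i j)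

    coloring-fixed : ∀ {F} → Legal T F → FixPlus T M v* (coloring F)
    coloring-fixed {F} legal@(F-sym , _ , balanced) = fixed , walkParity-closed acyclic _ L-sym (connected v* v*)
      where
      L-sym : ∀ i j → crossing M (F i j) ≡ crossing M (F j i)
      L-sym i j = cong (crossing M) (F-sym i j)

      fixed : ∀ v → step-of T M (coloring F) v ≡ coloring F v
      fixed v = Equivalence.from (fixed⇔ M (coloring F) v)
        (subst (λ k → 2 * k ≤ deg graph v) (count-cong (conflicts-coloring legal v)) (balanced v))

    coloring-conflicts : ∀ {c} → c v* ≡ false → ∀ v → coloring (conflicts M c) v ≡ c v
    coloring-conflicts {c} c*≡0 v =
      trans (walkParity-telescopes c crosses (connected v* v)) (cong (_xor c v) c*≡0)
      where
      crosses : ∀ u w → Adj graph u w → crossing M (conflicts M c u w) ≡ c u xor c w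
      crosses u w u~w rewrite u~w = crossing-involutive M (c u xor c w)

    coloring-injective : ∀ {F G} → Legal T F → Legal T G →
      (∀ v → coloring F v ≡ coloring G v) → ∀ u w → F u w ≡ G u w
    coloring-injective {F} {G} F-legal G-legal same u w = begin
      F u w                           ≡⟨ conflicts-coloring F-legal u w ⟩
      conflicts M (coloring F) u w    ≡⟨ conflicts-cong M same u w ⟩
      conflicts M (coloring G) u w    ≡⟨ conflicts-coloring G-legal u w ⟨
      G u w                           ∎
      where open ≡-Reasoning

theorem3 : ∀ {n : ℕ} (T : Tree n) (v* : Fin n) (M : Process) →
    Bijection (Efix T) (FixSet T M v*)
theorem3 T v* M = record
  { to        = λ (F , legal) → coloring T M v* F , coloring-fixed T M v* legal
  ; cong      = coloring-cong T M v*
  ; bijective = (λ {F} {G} → coloring-injective T M v* (proj₂ F) (proj₂ G))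
              , λ (c , fixed , c*≡0) → (conflicts T M c , conflicts-legal T M c fixed)
                , λ G≈F v → trans (coloring-cong T M v* G≈F v) (coloring-conflicts T M v* c*≡0 v)
  }
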